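{- Let $k\geq 1$. Every automorphism $\alpha$ of $\Omega_{2k}$ satisfies $\alpha(\mathbf{u}+\mathbf{1}) = \alpha(\mathbf{u})+\mathbf{1}$ for all $\mathbf{u}\in V(\Omega_{2k})$.
   Context: The orthogonality graph $\Omega_{2k}$ has vertex set $\mathbb{Z}_2^{2k}$ (bitstrings of length $2k$), with two vertices adjacent if and only if they differ in exactly $k$ positions. $\mathbf{1}$ is the all-ones bitstring and $+$ is bitwise addition mod 2. -}

module Defs where

open import Data.Nat using (ℕ; zero; suc; _+_; _*_)
open import Data.Bool using (Bool; true; false; _xor_)
open import Data.Vec using (Vec; []; _∷_; zipWith; replicate)
open import Relation.Binary.PropositionalEquality using (_≡_)
open import Function.Bundles using (_⤖_; Bijection)

V : ℕ → Set
V k = Vec Bool (2 * k)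

hamming : ∀ {n} → Vec Bool n → Vec Bool n → ℕ
hamming [] [] = 0
hamming (x ∷ xs) (y ∷ ys) with x xor y
... | true  = suc (hamming xs ys)
... | false = hamming xs ys

Adj : (k : ℕ) → V k → V k → Set
Adj k u v = hamming u v ≡ k

_⊕_ : ∀ {n} → Vec Bool n → Vec Bool n → Vec Bool n
_⊕_ = zipWith _xor_

𝟏 : ∀ {n} → Vec Bool n
𝟏 = replicate _ true

record Automorphism (k : ℕ) : Set where
  field
    bij  : V k ⤖ V k
  open Bijection bij public using (to)
  field
    preserves : ∀ u v → Adj k u v → Adj k (to u) (to v)
    reflects  : ∀ u v → Adj k (to u) (to v) → Adj k u v

module Submission where

-- The antipode u + 𝟏 is at distance 2k from u, so it is adjacent to every
-- neighbour of u. Conversely, if w is neither u nor u + 𝟏, then e = w + u has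
-- weight d with 0 < d < 2k, and a weight-k vector z overlapping e as much as
-- possible gives a neighbour u + z of u at distance |d - k| ≠ k from w. So u + 𝟏
-- is the only vertex other than u whose neighbourhood contains that of u, a
-- property every automorphism preserves.

open import Defs
open import Data.Nat using (ℕ; zero; suc; _+_; _*_; _∸_; _≤_; _≥_; z≤n; s≤s; s≤s⁻¹; _≤?_)
open import Data.Nat.Properties
open import Data.Bool using (Bool; true; false; _xor_)
import Data.Bool.Properties as Bool
open import Data.Vec using (Vec; []; _∷_)
open import Data.Vec.Properties using (≡-dec; zipWith-assoc)
open import Data.Product using (_×_; _,_; ∃)
open import Data.Empty using (⊥-elim)
open import Function using (_∘_)
open import Function.Bundles using (Bijection)
open import Relation.Nullary using (yes; no)
open import Relation.Binary.PropositionalEquality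
  using (_≡_; _≢_; refl; sym; trans; cong; cong₂; module ≡-Reasoning)

weight : ∀ {n} → Vec Bool n → ℕ
weight []           = 0
weight (true  ∷ xs) = suc (weight xs)
weight (false ∷ xs) = weight xs

zeros : ∀ {n} → Vec Bool n → ℕ
zeros []           = 0
zeros (true  ∷ xs) = zeros xs
zeros (false ∷ xs) = suc (zeros xs)

weight+zeros≡length : ∀ {n} (e : Vec Bool n) → weight e + zeros e ≡ n
weight+zeros≡length []          = refl
weight+zeros≡length (true  ∷ e) = cong suc (weight+zeros≡length e)
weight+zeros≡length (false ∷ e) =
  trans (+-suc (weight e) (zeros e)) (cong suc (weight+zeros≡length e))

⊕-assoc : ∀ {n} (x y z : Vec Bool n) → (x ⊕ y) ⊕ z ≡ x ⊕ (y ⊕ z)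
⊕-assoc = zipWith-assoc Bool.xor-assoc

⊕-cancelˡ : ∀ {n} (x z : Vec Bool n) → x ⊕ (x ⊕ z) ≡ z
⊕-cancelˡ []      []      = refl
⊕-cancelˡ (a ∷ x) (b ∷ z) =
  cong₂ _∷_ (trans (sym (Bool.xor-assoc a a b)) (cong (_xor b) (Bool.xor-same a)))
            (⊕-cancelˡ x z)

⊕𝟏-≢ : ∀ {n} (u : Vec Bool (suc n)) → u ⊕ 𝟏 ≢ u
⊕𝟏-≢ (true  ∷ u) ()
⊕𝟏-≢ (false ∷ u) ()

hamming≡weight-⊕ : ∀ {n} (x y : Vec Bool n) → hamming x y ≡ weight (x ⊕ y)
hamming≡weight-⊕ []          []          = refl
hamming≡weight-⊕ (true  ∷ x) (true  ∷ y) = hamming≡weight-⊕ x y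
hamming≡weight-⊕ (true  ∷ x) (false ∷ y) = cong suc (hamming≡weight-⊕ x y)
hamming≡weight-⊕ (false ∷ x) (true  ∷ y) = cong suc (hamming≡weight-⊕ x y)
hamming≡weight-⊕ (false ∷ x) (false ∷ y) = hamming≡weight-⊕ x y

hamming-⊕𝟏+hamming≡length : ∀ {n} (u v : Vec Bool n) → hamming (u ⊕ 𝟏) v + hamming u v ≡ n
hamming-⊕𝟏+hamming≡length []          []          = refl
hamming-⊕𝟏+hamming≡length (true  ∷ u) (true  ∷ v) =
  cong suc (hamming-⊕𝟏+hamming≡length u v)
hamming-⊕𝟏+hamming≡length (true  ∷ u) (false ∷ v) =
  trans (+-suc _ _) (cong suc (hamming-⊕𝟏+hamming≡length u v))
hamming-⊕𝟏+hamming≡length (false ∷ u) (true  ∷ v) =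
  trans (+-suc _ _) (cong suc (hamming-⊕𝟏+hamming≡length u v))
hamming-⊕𝟏+hamming≡length (false ∷ u) (false ∷ v) =
  cong suc (hamming-⊕𝟏+hamming≡length u v)

hamming≡0⇒≡ : ∀ {n} (w u : Vec Bool n) → hamming w u ≡ 0 → w ≡ u
hamming≡0⇒≡ []          []          _ = refl
hamming≡0⇒≡ (true  ∷ w) (true  ∷ u) h = cong (true ∷_) (hamming≡0⇒≡ w u h)
hamming≡0⇒≡ (false ∷ w) (false ∷ u) h = cong (false ∷_) (hamming≡0⇒≡ w u h)
hamming≡0⇒≡ (true  ∷ w) (false ∷ u) ()
hamming≡0⇒≡ (false ∷ w) (true  ∷ u) ()

hamming≤length : ∀ {n} (w u : Vec Bool n) → hamming w u ≤ n
hamming≤length []          []          = z≤n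
hamming≤length (true  ∷ w) (true  ∷ u) = m≤n⇒m≤1+n (hamming≤length w u)
hamming≤length (false ∷ w) (false ∷ u) = m≤n⇒m≤1+n (hamming≤length w u)
hamming≤length (true  ∷ w) (false ∷ u) = s≤s (hamming≤length w u)
hamming≤length (false ∷ w) (true  ∷ u) = s≤s (hamming≤length w u)

hamming≡length⇒≡⊕𝟏 : ∀ {n} (w u : Vec Bool n) → hamming w u ≡ n → w ≡ u ⊕ 𝟏
hamming≡length⇒≡⊕𝟏 []          []          _ = refl
hamming≡length⇒≡⊕𝟏 (true  ∷ w) (false ∷ u) h =
  cong (true ∷_) (hamming≡length⇒≡⊕𝟏 w u (suc-injective h))
hamming≡length⇒≡⊕𝟏 (false ∷ w) (true  ∷ u) h =
  cong (false ∷_) (hamming≡length⇒≡⊕𝟏 w u (suc-injective h))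
hamming≡length⇒≡⊕𝟏 (true  ∷ w) (true  ∷ u) h = ⊥-elim (<-irrefl h (s≤s (hamming≤length w u)))
hamming≡length⇒≡⊕𝟏 (false ∷ w) (false ∷ u) h = ⊥-elim (<-irrefl h (s≤s (hamming≤length w u)))

pick : ∀ {n} → Vec Bool n → ℕ → ℕ → Vec Bool n
pick []          a       b       = []
pick (true  ∷ e) zero    b       = false ∷ pick e zero b
pick (true  ∷ e) (suc a) b       = true ∷ pick e a b
pick (false ∷ e) a       zero    = false ∷ pick e a zero
pick (false ∷ e) a       (suc b) = true ∷ pick e a b

weight-pick : ∀ {n} (e : Vec Bool n) {a b} → a ≤ weight e → b ≤ zeros e →
              weight (pick e a b) ≡ a + b
weight-pick []          z≤n z≤n = refl
weight-pick (true  ∷ e) {zero}  {b}     _   b≤ = weight-pick e z≤n b≤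
weight-pick (true  ∷ e) {suc a} {b}     a≤  b≤ = cong suc (weight-pick e (s≤s⁻¹ a≤) b≤)
weight-pick (false ∷ e) {a}     {zero}  a≤  _  = weight-pick e a≤ z≤n
weight-pick (false ∷ e) {a}     {suc b} a≤  b≤ =
  trans (cong suc (weight-pick e a≤ (s≤s⁻¹ b≤))) (sym (+-suc a b))

weight-⊕-pick : ∀ {n} (e : Vec Bool n) {a b} → a ≤ weight e → b ≤ zeros e →
                weight (e ⊕ pick e a b) ≡ (weight e ∸ a) + b
weight-⊕-pick []          z≤n z≤n = refl
weight-⊕-pick (true  ∷ e) {zero}  {b}     _   b≤ = cong suc (weight-⊕-pick e z≤n b≤)
weight-⊕-pick (true  ∷ e) {suc a} {b}     a≤  b≤ = weight-⊕-pick e (s≤s⁻¹ a≤) b≤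
weight-⊕-pick (false ∷ e) {a}     {zero}  a≤  _  = weight-⊕-pick e a≤ z≤n
weight-⊕-pick (false ∷ e) {a}     {suc b} a≤  b≤ =
  trans (cong suc (weight-⊕-pick e a≤ (s≤s⁻¹ b≤))) (sym (+-suc _ b))

∃-weight≡k-with-weight-⊕≢k : ∀ {n} k (e : Vec Bool n) → k ≤ n →
  weight e ≢ 0 → weight e ≢ 2 * k → ∃ λ z → weight z ≡ k × weight (e ⊕ z) ≢ k
∃-weight≡k-with-weight-⊕≢k {n} k e k≤n d≢0 d≢2k with weight e ≤? k
... | yes d≤k = pick e d (k ∸ d) , weight≡k , weight-⊕≢k
  where
  d = weight e
  k∸d≤zeros : k ∸ d ≤ zeros e
  k∸d≤zeros = begin
    k ∸ d              ≤⟨ ∸-monoˡ-≤ d k≤n ⟩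
    n ∸ d              ≡⟨ cong (_∸ d) (sym (weight+zeros≡length e)) ⟩
    d + zeros e ∸ d    ≡⟨ m+n∸m≡n d (zeros e) ⟩
    zeros e            ∎
    where open ≤-Reasoning
  weight≡k : weight (pick e d (k ∸ d)) ≡ k
  weight≡k = trans (weight-pick e ≤-refl k∸d≤zeros) (m+[n∸m]≡n d≤k)
  weight-⊕≢k : weight (e ⊕ pick e d (k ∸ d)) ≢ k
  weight-⊕≢k h = <-irrefl k∸d≡k (∸-monoʳ-< (n≢0⇒n>0 d≢0) d≤k)
    where
    k∸d≡k : k ∸ d ≡ k
    k∸d≡k = begin
      k ∸ d                       ≡⟨ cong (_+ (k ∸ d)) (sym (n∸n≡0 d)) ⟩
      (d ∸ d) + (k ∸ d)           ≡⟨ sym (weight-⊕-pick e ≤-refl k∸d≤zeros) ⟩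
      weight (e ⊕ pick e d (k ∸ d)) ≡⟨ h ⟩
      k                           ∎
      where open ≡-Reasoning
... | no d≰k = pick e k 0 , weight≡k , weight-⊕≢k
  where
  d = weight e
  k≤d : k ≤ d
  k≤d = <⇒≤ (≰⇒> d≰k)
  weight≡k : weight (pick e k 0) ≡ k
  weight≡k = trans (weight-pick e k≤d z≤n) (+-identityʳ k)
  weight-⊕≢k : weight (e ⊕ pick e k 0) ≢ k
  weight-⊕≢k h = d≢2k (begin
    d                  ≡⟨ sym (m+[n∸m]≡n k≤d) ⟩
    k + (d ∸ k)        ≡⟨ cong (k +_) (sym (+-identityʳ (d ∸ k))) ⟩
    k + (d ∸ k + 0)    ≡⟨ cong (k +_) (trans (sym (weight-⊕-pick e k≤d z≤n)) h) ⟩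
    k + k              ≡⟨ cong (k +_) (sym (+-identityʳ k)) ⟩
    2 * k              ∎)
    where open ≡-Reasoning

∃-neighbour-not-shared : ∀ {n} k (u w : Vec Bool n) → k ≤ n → w ≢ u → hamming w u ≢ 2 * k →
                         ∃ λ v → hamming u v ≡ k × hamming w v ≢ k
∃-neighbour-not-shared k u w k≤n w≢u d≢2k
  with ∃-weight≡k-with-weight-⊕≢k k (w ⊕ u) k≤n
         (w≢u ∘ hamming≡0⇒≡ w u ∘ trans (hamming≡weight-⊕ w u))
         (d≢2k ∘ trans (hamming≡weight-⊕ w u))
... | z , weight-z≡k , weight-⊕≢k = u ⊕ z , u~v , w≁v
  where
  u~v : hamming u (u ⊕ z) ≡ k
  u~v = trans (hamming≡weight-⊕ u (u ⊕ z)) (trans (cong weight (⊕-cancelˡ u z)) weight-z≡k)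
  w≁v : hamming w (u ⊕ z) ≢ k
  w≁v h = weight-⊕≢k (begin
    weight ((w ⊕ u) ⊕ z)   ≡⟨ cong weight (⊕-assoc w u z) ⟩
    weight (w ⊕ (u ⊕ z))   ≡⟨ sym (hamming≡weight-⊕ w (u ⊕ z)) ⟩
    hamming w (u ⊕ z)      ≡⟨ h ⟩
    k                      ∎)
    where open ≡-Reasoning

Adj-⊕𝟏 : ∀ {k} (u v : V k) → Adj k u v → Adj k (u ⊕ 𝟏) v
Adj-⊕𝟏 {k} u v u~v = +-cancelʳ-≡ k _ _ (begin
  hamming (u ⊕ 𝟏) v + k             ≡⟨ cong (hamming (u ⊕ 𝟏) v +_) (sym u~v) ⟩
  hamming (u ⊕ 𝟏) v + hamming u v   ≡⟨ hamming-⊕𝟏+hamming≡length u v ⟩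
  2 * k                             ≡⟨ cong (k +_) (+-identityʳ k) ⟩
  k + k                             ∎)
  where open ≡-Reasoning

neighbours-shared⇒≡⊕𝟏 : ∀ k {u w : V k} → w ≢ u → (∀ v → Adj k u v → Adj k w v) → w ≡ u ⊕ 𝟏
neighbours-shared⇒≡⊕𝟏 k {u} {w} w≢u shared with ≡-dec Bool._≟_ w (u ⊕ 𝟏)
... | yes w≡u⊕𝟏 = w≡u⊕𝟏
... | no  w≢u⊕𝟏 with ∃-neighbour-not-shared k u w (m≤m+n k (k + 0)) w≢u
                       (w≢u⊕𝟏 ∘ hamming≡length⇒≡⊕𝟏 w u)
...   | v , u~v , w≁v = ⊥-elim (w≁v (shared v u~v))

lemma4 : (k : ℕ) → k ≥ 1 → (α : Automorphism k) → (u : V k) →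
             Automorphism.to α (u ⊕ 𝟏) ≡ Automorphism.to α u ⊕ 𝟏
lemma4 k@(suc _) _ α u = neighbours-shared⇒≡⊕𝟏 k (⊕𝟏-≢ u ∘ Bijection.injective bij) shared
  where
  open Automorphism α
  shared : ∀ v′ → Adj k (to u) v′ → Adj k (to (u ⊕ 𝟏)) v′
  shared v′ αu~v′ with Bijection.strictlySurjective bij v′
  ... | v , refl = preserves (u ⊕ 𝟏) v (Adj-⊕𝟏 u v (reflects u v αu~v′))
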